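{- Let $G=(V,E)$ be a connected graph and $c:V\to\mathbb{N}$ with $c_v\le d(v)$ for every $v\in V$. Run the following Edge Deletion algorithm: start with $Y=E$; go through the edges $e=(u,v)$ of $Y$ one by one (in any order), and delete $e$ from $Y$ if at that moment $d_Y(u)>c_u$ and $d_Y(v)>c_v$, where $d_Y(x)$ is the current degree of $x$ in $(V,Y)$; return the final $Y$. Then this algorithm has approximation ratio $2$ for PDBEP: the returned $Y$ is feasible and $|Y|\ge \mathrm{OPT}/2$.
   Context: Partial Degree Bounded Edge Packing (PDBEP): given a graph $G=(V,E)$ and $c:V\to\mathbb{N}$, a set $E'\subseteq E$ is feasible if for every edge $(u,v)\in E'$ we have $d'_u\le c_u$ or $d'_v\le c_v$, where $d'_x$ denotes the degree of $x$ in $(V,E')$. $\mathrm{OPT}$ is the maximum cardinality of a feasible set. $d(v)$ denotes the degree of $v$ in $G$. -}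

module Defs where

open import Data.Nat using (ℕ; _≤_; _<_; _<?_)
open import Data.Fin using (Fin; toℕ)
open import Data.Fin.Properties using () renaming (_≟_ to _≟ᶠ_)
open import Data.Product using (_×_; _,_)
open import Data.Product.Properties using (≡-dec)
open import Data.Sum using (_⊎_)
open import Data.List using (List; []; _∷_; length; filter)
open import Data.List.Membership.Propositional using (_∈_)
open import Data.List.Relation.Unary.All using (All)
open import Data.List.Relation.Unary.Unique.Propositional using (Unique)
open import Relation.Binary.PropositionalEquality using (_≡_)
open import Relation.Nullary using (Dec; yes; no; ¬?)
open import Relation.Nullary.Decidable using (_⊎-dec_)

-- Vertices are Fin n.  An edge {u,v} of a simple graph is stored canonically
-- as the ordered pair (u , v) with toℕ u < toℕ v.
Edge : ℕ → Set
Edge n = Fin n × Fin n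

_≟ₑ_ : ∀ {n} (e f : Edge n) → Dec (e ≡ f)
_≟ₑ_ = ≡-dec _≟ᶠ_ _≟ᶠ_

record SimpleGraph (n : ℕ) : Set where
  field
    edges     : List (Edge n)
    canonical : All (λ e → toℕ (Data.Product.proj₁ e) < toℕ (Data.Product.proj₂ e)) edges
    unique    : Unique edges
open SimpleGraph public

Incident : ∀ {n} → Fin n → Edge n → Set
Incident x (u , v) = x ≡ u ⊎ x ≡ v

incident? : ∀ {n} (x : Fin n) (e : Edge n) → Dec (Incident x e)
incident? x (u , v) = (x ≟ᶠ u) ⊎-dec (x ≟ᶠ v)

deg : ∀ {n} → List (Edge n) → Fin n → ℕ
deg Y x = length (filter (incident? x) Y)

data Reachable {n} (Y : List (Edge n)) : Fin n → Fin n → Set where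
  here  : ∀ {u} → Reachable Y u u
  fwd   : ∀ {u v w} → (u , v) ∈ Y → Reachable Y v w → Reachable Y u w
  bwd   : ∀ {u v w} → (v , u) ∈ Y → Reachable Y v w → Reachable Y u w

Connected : ∀ {n} → SimpleGraph n → Set
Connected G = ∀ u v → Reachable (edges G) u v

Feasible : ∀ {n} → (Fin n → ℕ) → List (Edge n) → Set
Feasible c E' = ∀ {u v} → (u , v) ∈ E' → deg E' u ≤ c u ⊎ deg E' v ≤ c v

remove : ∀ {n} → Edge n → List (Edge n) → List (Edge n)
remove e Y = filter (λ f → ¬? (f ≟ₑ e)) Y

step : ∀ {n} → (Fin n → ℕ) → List (Edge n) → Edge n → List (Edge n)
step c Y (u , v) with c u <? deg Y u | c v <? deg Y v
... | yes _ | yes _ = remove (u , v) Y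
... | _     | _     = Y

run : ∀ {n} → (Fin n → ℕ) → List (Edge n) → List (Edge n) → List (Edge n)
run c Y []      = Y
run c Y (e ∷ σ) = run c (step c Y e) σ

edgeDeletion : ∀ {n} → SimpleGraph n → (Fin n → ℕ) → List (Edge n) → List (Edge n)
edgeDeletion G c σ = run c (edges G) σ

module Submission where

-- Let Y be the output and E' any feasible edge set.
--  * Y is feasible: an edge surviving its own examination has an endpoint x
--    with d_Y(x) ≤ c_x, and degrees only decrease afterwards.
--  * Y is saturated (c_x ≤ d_Y(x) for all x): this holds for E, and an edge
--    is deleted only when both its endpoints have degree > c.
--  * Counting bound: charging each edge of E' to an endpoint x with
--    d_{E'}(x) ≤ c_x gives |E'| ≤ Σ_x c_x.
-- Hence |E'| ≤ Σ c ≤ Σ d_Y ≤ 2|Y| by the handshake inequality.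

open import Defs
open import Data.Bool using (true; false; if_then_else_)
open import Data.Nat using (ℕ; zero; suc; _≤_; _<_; _*_; _+_; _≤?_; z≤n; s≤s)
open import Data.Nat.Properties
open import Data.Fin using (Fin; zero; suc)
open import Data.Fin.Properties using () renaming (_≟_ to _≟ᶠ_)
open import Data.Product using (_×_; _,_; proj₂)
open import Data.Sum using (_⊎_; inj₁; inj₂)
open import Data.Empty using (⊥-elim)
open import Data.List using (List; []; _∷_; length; map)
open import Data.Nat.ListAction using (sum)
open import Data.List.Properties using (filter-all)
open import Data.List.Membership.Propositional using (_∈_)
open import Data.List.Membership.Propositional.Properties using (∈-filter⁻)
open import Data.List.Relation.Unary.Any using (here; there)
open import Data.List.Relation.Unary.All as All using (All)
open import Data.List.Relation.Binary.Permutation.Propositional using (_↭_; ↭-sym)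
open import Data.List.Relation.Binary.Permutation.Propositional.Properties using (∈-resp-↭)
open import Data.List.Relation.Binary.Subset.Propositional using (_⊆_)
open import Data.List.Relation.Binary.Sublist.Propositional
  using (lookup) renaming (_⊆_ to _⊑_; ⊆-refl to ⊑-refl)
open import Data.List.Relation.Binary.Sublist.Propositional.Properties
  using (filter⁺; filter-⊆; length-mono-≤)
open import Data.List.Relation.Unary.Unique.Propositional using (Unique; []; _∷_)
import Data.List.Relation.Unary.Unique.Propositional.Properties as Unique
open import Algebra.Properties.CommutativeMonoid.Sum +-0-commutativeMonoid
  using (sum-syntax; ∑-distrib-+; sum-cong-≗; sum-replicate-zero)
open import Relation.Binary.PropositionalEquality
open import Relation.Nullary using (Dec; yes; no; does; ¬?; ¬_; _⊎-dec_)

iverson : ∀ {P : Set} → Dec P → ℕ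
iverson d = if does d then 1 else 0

iverson-yes : ∀ {P : Set} (d : Dec P) → P → iverson d ≡ 1
iverson-yes (yes _) _ = refl
iverson-yes (no ¬p) p = ⊥-elim (¬p p)

iverson-no : ∀ {P : Set} (d : Dec P) → ¬ P → iverson d ≡ 0
iverson-no (yes p) ¬p = ⊥-elim (¬p p)
iverson-no (no _)  _  = refl

iverson-* : ∀ {P : Set} (d : Dec P) {m k : ℕ} → (P → m ≤ k) → iverson d * m ≤ k
iverson-* (yes p) {m} m≤k = ≤-trans (≤-reflexive (+-identityʳ m)) (m≤k p)
iverson-* (no _)      _   = z≤n

iverson-⊎ : ∀ {P Q : Set} (p : Dec P) (q : Dec Q) → iverson (p ⊎-dec q) ≤ iverson p + iverson q
iverson-⊎ p q with does p | does q
... | true  | _     = s≤s z≤n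
... | false | true  = ≤-refl
... | false | false = z≤n

∑-mono : ∀ {n} {f g : Fin n → ℕ} → (∀ x → f x ≤ g x) → ∑[ x < n ] f x ≤ ∑[ x < n ] g x
∑-mono {zero}  f≤g = z≤n
∑-mono {suc n} f≤g = +-mono-≤ (f≤g zero) (∑-mono (λ x → f≤g (suc x)))

∑-term : ∀ {n} (f : Fin n → ℕ) (u : Fin n) → f u ≤ ∑[ x < n ] f x
∑-term f zero    = m≤m+n _ _
∑-term f (suc u) = ≤-trans (∑-term (λ x → f (suc x)) u) (m≤n+m _ _)

∑-point-mass : ∀ {n} (u : Fin n) → ∑[ x < n ] iverson (x ≟ᶠ u) ≤ 1
∑-point-mass {suc n} zero = s≤s (≤-reflexive (sum-replicate-zero n))
∑-point-mass {suc n} (suc u) = ∑-point-mass u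

incidence : ∀ {n} → Fin n → Edge n → ℕ
incidence x e = iverson (incident? x e)

deg-∷ : ∀ {n} (e : Edge n) (L : List (Edge n)) (x : Fin n) →
  deg (e ∷ L) x ≡ incidence x e + deg L x
deg-∷ e L x with does (incident? x e)
... | true  = refl
... | false = refl

∑-incidence : ∀ {n} (e : Edge n) → ∑[ x < n ] incidence x e ≤ 2
∑-incidence {n} (u , v) = begin
  ∑[ x < n ] incidence x (u , v)                       ≤⟨ ∑-mono (λ x → iverson-⊎ (x ≟ᶠ u) (x ≟ᶠ v)) ⟩
  ∑[ x < n ] (iverson (x ≟ᶠ u) + iverson (x ≟ᶠ v))     ≡⟨ ∑-distrib-+ (λ x → iverson (x ≟ᶠ u)) (λ x → iverson (x ≟ᶠ v)) ⟩
  ∑[ x < n ] iverson (x ≟ᶠ u) + ∑[ x < n ] iverson (x ≟ᶠ v) ≤⟨ +-mono-≤ (∑-point-mass u) (∑-point-mass v) ⟩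
  2                                                    ∎
  where open ≤-Reasoning

handshake : ∀ {n} (h : Fin n → ℕ) (L : List (Edge n)) →
  ∑[ x < n ] (h x * deg L x) ≡ sum (map (λ e → ∑[ x < n ] (h x * incidence x e)) L)
handshake {n} h [] = trans (sum-cong-≗ (λ x → *-zeroʳ (h x))) (sum-replicate-zero n)
handshake {n} h (e ∷ L) = begin
  ∑[ x < n ] (h x * deg (e ∷ L) x)
    ≡⟨ sum-cong-≗ {n} (λ x → trans (cong (h x *_) (deg-∷ e L x)) (*-distribˡ-+ (h x) _ _)) ⟩
  ∑[ x < n ] (h x * incidence x e + h x * deg L x)
    ≡⟨ ∑-distrib-+ (λ x → h x * incidence x e) (λ x → h x * deg L x) ⟩
  ∑[ x < n ] (h x * incidence x e) + ∑[ x < n ] (h x * deg L x)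
    ≡⟨ cong (∑[ x < n ] (h x * incidence x e) +_) (handshake h L) ⟩
  sum (map (λ f → ∑[ x < n ] (h x * incidence x f)) (e ∷ L)) ∎
  where open ≡-Reasoning

sum-map-≤ : ∀ {A : Set} (w : A → ℕ) {k : ℕ} → (∀ a → w a ≤ k) → (L : List A) →
  sum (map w L) ≤ k * length L
sum-map-≤ w {k} w≤k []      = ≤-reflexive (sym (*-zeroʳ k))
sum-map-≤ w {k} w≤k (a ∷ L) = begin
  w a + sum (map w L) ≤⟨ +-mono-≤ (w≤k a) (sum-map-≤ w w≤k L) ⟩
  k + k * length L    ≡⟨ sym (*-suc k (length L)) ⟩
  k * length (a ∷ L)  ∎
  where open ≤-Reasoning

length-≤-sum : ∀ {A : Set} (w : A → ℕ) (L : List A) → (∀ {a} → a ∈ L → 1 ≤ w a) →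
  length L ≤ sum (map w L)
length-≤-sum w []      w≥1 = z≤n
length-≤-sum w (a ∷ L) w≥1 = +-mono-≤ (w≥1 (here refl)) (length-≤-sum w L (λ a∈L → w≥1 (there a∈L)))

∑-deg : ∀ {n} (L : List (Edge n)) → ∑[ x < n ] deg L x ≤ 2 * length L
∑-deg {n} L = begin
  ∑[ x < n ] deg L x                                  ≡⟨ sum-cong-≗ {n} (λ x → sym (*-identityˡ (deg L x))) ⟩
  ∑[ x < n ] (1 * deg L x)                            ≡⟨ handshake (λ _ → 1) L ⟩
  sum (map (λ e → ∑[ x < n ] (1 * incidence x e)) L) ≤⟨ sum-map-≤ _ edge-weight L ⟩
  2 * length L                                        ∎
  where
  open ≤-Reasoning
  edge-weight : ∀ e → ∑[ x < n ] (1 * incidence x e) ≤ 2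
  edge-weight e = ≤-trans (≤-reflexive (sum-cong-≗ {n} (λ x → *-identityˡ (incidence x e)))) (∑-incidence e)

-- Give weight 1 to the "light" vertices x with d_{E'}(x) ≤ c_x and weight 0
-- to the others.  Feasibility says every edge has a light endpoint, so it
-- has weight ≥ 1, while a light vertex contributes d_{E'}(x) ≤ c_x to the
-- weighted degree sum.
feasible-≤-∑c : ∀ {n} (c : Fin n → ℕ) (E' : List (Edge n)) → Feasible c E' →
  length E' ≤ ∑[ x < n ] c x
feasible-≤-∑c {n} c E' feasible = begin
  length E'                                                ≤⟨ length-≤-sum _ E' has-light-endpoint ⟩
  sum (map (λ e → ∑[ x < n ] (light x * incidence x e)) E') ≡⟨ sym (handshake light E') ⟩
  ∑[ x < n ] (light x * deg E' x)                          ≤⟨ ∑-mono (λ x → iverson-* (deg E' x ≤? c x) (λ d≤c → d≤c)) ⟩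
  ∑[ x < n ] c x                                           ∎
  where
  open ≤-Reasoning
  light : Fin n → ℕ
  light x = iverson (deg E' x ≤? c x)

  endpoint : ∀ e w → Incident w e → light w ≤ ∑[ x < n ] (light x * incidence x e)
  endpoint e w w∈e = begin
    light w                 ≡⟨ sym (*-identityʳ (light w)) ⟩
    light w * 1             ≡⟨ cong (light w *_) (sym (iverson-yes (incident? w e) w∈e)) ⟩
    light w * incidence w e ≤⟨ ∑-term (λ x → light x * incidence x e) w ⟩
    ∑[ x < n ] (light x * incidence x e) ∎

  has-light-endpoint : ∀ {e} → e ∈ E' → 1 ≤ ∑[ x < n ] (light x * incidence x e)
  has-light-endpoint {u , v} uv∈E' with feasible uv∈E'
  ... | inj₁ du≤c = ≤-trans (≤-reflexive (sym (iverson-yes (deg E' u ≤? c u) du≤c))) (endpoint (u , v) u (inj₁ refl))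
  ... | inj₂ dv≤c = ≤-trans (≤-reflexive (sym (iverson-yes (deg E' v ≤? c v) dv≤c))) (endpoint (u , v) v (inj₂ refl))

remove-⊑ : ∀ {n} (e : Edge n) (Y : List (Edge n)) → remove e Y ⊑ Y
remove-⊑ e Y = filter-⊆ (λ f → ¬? (f ≟ₑ e)) Y

deg-mono : ∀ {n} {Y' Y : List (Edge n)} → Y' ⊑ Y → ∀ x → deg Y' x ≤ deg Y x
deg-mono Y'⊑Y x = length-mono-≤ (filter⁺ (incident? x) (incident? x) (λ { refl p → p }) Y'⊑Y)

remove-∉ : ∀ {n} (e : Edge n) {Y : List (Edge n)} → All (λ f → e ≢ f) Y → remove e Y ≡ Y
remove-∉ e e∉Y = filter-all (λ f → ¬? (f ≟ₑ e)) (All.map (λ e≢f f≡e → e≢f (sym f≡e)) e∉Y)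

deg-remove : ∀ {n} (e : Edge n) {Y : List (Edge n)} → Unique Y → ∀ x →
  deg Y x ≤ deg (remove e Y) x + incidence x e
deg-remove e [] x = z≤n
deg-remove e {f ∷ Y} (f∉Y ∷ uY) x with f ≟ₑ e
... | yes refl = ≤-reflexive (begin
  deg (f ∷ Y) x                   ≡⟨ deg-∷ f Y x ⟩
  incidence x f + deg Y x         ≡⟨ +-comm (incidence x f) (deg Y x) ⟩
  deg Y x + incidence x f         ≡⟨ cong (λ Z → deg Z x + incidence x f) (sym (remove-∉ f f∉Y)) ⟩
  deg (remove f Y) x + incidence x f ∎)
  where open ≡-Reasoning
... | no f≢e = begin
  deg (f ∷ Y) x                                    ≡⟨ deg-∷ f Y x ⟩
  incidence x f + deg Y x                          ≤⟨ +-monoʳ-≤ (incidence x f) (deg-remove e uY x) ⟩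
  incidence x f + (deg (remove e Y) x + incidence x e) ≡⟨ sym (+-assoc (incidence x f) _ _) ⟩
  incidence x f + deg (remove e Y) x + incidence x e   ≡⟨ cong (_+ incidence x e) (sym (deg-∷ f (remove e Y) x)) ⟩
  deg (f ∷ remove e Y) x + incidence x e           ∎
  where open ≤-Reasoning

data StepOutcome {n} (c : Fin n → ℕ) (Y : List (Edge n)) (u v : Fin n) : List (Edge n) → Set where
  deleted : c u < deg Y u → c v < deg Y v → StepOutcome c Y u v (remove (u , v) Y)
  kept    : deg Y u ≤ c u ⊎ deg Y v ≤ c v → StepOutcome c Y u v Y

step-outcome : ∀ {n} (c : Fin n → ℕ) (Y : List (Edge n)) (u v : Fin n) →
  StepOutcome c Y u v (step c Y (u , v))
step-outcome c Y u v with c u <? deg Y u | c v <? deg Y v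
... | yes cu<du | yes cv<dv = deleted cu<du cv<dv
... | yes _     | no  cv≮dv = kept (inj₂ (≮⇒≥ cv≮dv))
... | no  cu≮du | _         = kept (inj₁ (≮⇒≥ cu≮du))

step-⊑ : ∀ {n} (c : Fin n → ℕ) (Y : List (Edge n)) (e : Edge n) → step c Y e ⊑ Y
step-⊑ c Y (u , v) with step c Y (u , v) | step-outcome c Y u v
... | _ | deleted _ _ = remove-⊑ (u , v) Y
... | _ | kept _      = ⊑-refl

step-settles : ∀ {n} (c : Fin n → ℕ) (Y : List (Edge n)) (u v : Fin n) →
  (u , v) ∈ step c Y (u , v) →
  deg (step c Y (u , v)) u ≤ c u ⊎ deg (step c Y (u , v)) v ≤ c v
step-settles c Y u v uv∈Y' with step c Y (u , v) | step-outcome c Y u v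
... | _ | deleted _ _ = ⊥-elim (proj₂ (∈-filter⁻ (λ f → ¬? (f ≟ₑ (u , v))) {xs = Y} uv∈Y') refl)
... | _ | kept light  = light

Saturated : ∀ {n} → (Fin n → ℕ) → List (Edge n) → Set
Saturated {n} c Y = Unique Y × (∀ (x : Fin n) → c x ≤ deg Y x)

step-saturated : ∀ {n} (c : Fin n → ℕ) (Y : List (Edge n)) (e : Edge n) →
  Saturated c Y → Saturated c (step c Y e)
step-saturated c Y (u , v) (uY , c≤d) with step c Y (u , v) | step-outcome c Y u v
... | _ | kept _ = uY , c≤d
... | _ | deleted cu<du cv<dv =
  Unique.filter⁺ (λ f → ¬? (f ≟ₑ (u , v))) uY ,
  λ x → +-cancelʳ-≤ (incidence x (u , v)) (c x) _
          (≤-trans (room x) (deg-remove (u , v) uY x))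
  where
  room : ∀ x → c x + incidence x (u , v) ≤ deg Y x
  room x with incident? x (u , v)
  ... | yes x∈uv rewrite iverson-yes (incident? x (u , v)) x∈uv = ≤-trans (≤-reflexive (+-comm (c x) 1)) (heavy x∈uv)
    where
    heavy : ∀ {x} → Incident x (u , v) → c x < deg Y x
    heavy (inj₁ refl) = cu<du
    heavy (inj₂ refl) = cv<dv
  ... | no  x∉uv rewrite iverson-no (incident? x (u , v)) x∉uv = ≤-trans (≤-reflexive (+-identityʳ (c x))) (c≤d x)

SettledExcept : ∀ {n} → (Fin n → ℕ) → List (Edge n) → List (Edge n) → Set
SettledExcept c Y rest =
  ∀ {u v} → (u , v) ∈ Y → (u , v) ∈ rest ⊎ (deg Y u ≤ c u ⊎ deg Y v ≤ c v)

-- examining e settles e, and satisfied edges stay satisfied since degrees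
-- only decrease
step-settled : ∀ {n} (c : Fin n → ℕ) (Y : List (Edge n)) (e : Edge n) (rest : List (Edge n)) →
  SettledExcept c Y (e ∷ rest) → SettledExcept c (step c Y e) rest
step-settled c Y e rest settled {u} {v} uv∈Y' with settled (lookup (step-⊑ c Y e) uv∈Y')
... | inj₁ (here refl)    = inj₂ (step-settles c Y u v uv∈Y')
... | inj₁ (there uv∈rest) = inj₁ uv∈rest
... | inj₂ (inj₁ du≤c)    = inj₂ (inj₁ (≤-trans (deg-mono (step-⊑ c Y e) u) du≤c))
... | inj₂ (inj₂ dv≤c)    = inj₂ (inj₂ (≤-trans (deg-mono (step-⊑ c Y e) v) dv≤c))

run-invariant : ∀ {n} (c : Fin n → ℕ) (P : List (Edge n) → List (Edge n) → Set) →
  (∀ Y e rest → P Y (e ∷ rest) → P (step c Y e) rest) →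
  ∀ Y σ → P Y σ → P (run c Y σ) []
run-invariant c P preserved Y []      PYσ = PYσ
run-invariant c P preserved Y (e ∷ σ) PYσ = run-invariant c P preserved (step c Y e) σ (preserved Y e σ PYσ)

theorem2 : ∀ {n} (G : SimpleGraph n) (c : Fin n → ℕ) →
    Connected G →
    (∀ v → c v ≤ deg (edges G) v) →
    (σ : List (Edge n)) → σ ↭ edges G →
    Feasible c (edgeDeletion G c σ) ×
    (∀ (E' : List (Edge n)) → Unique E' → E' ⊆ edges G → Feasible c E' →
    length E' ≤ 2 * length (edgeDeletion G c σ))
theorem2 {n} G c _ c≤d σ σ↭E = feasible , approximation
  where
  Y : List (Edge n)
  Y = edgeDeletion G c σ

  settled : SettledExcept c Y []
  settled = run-invariant c (SettledExcept c) (step-settled c) (edges G) σ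
              (λ uv∈E → inj₁ (∈-resp-↭ (↭-sym σ↭E) uv∈E))

  feasible : Feasible c Y
  feasible uv∈Y with settled uv∈Y
  ... | inj₂ light = light

  saturated : Saturated c Y
  saturated = run-invariant c (λ Z _ → Saturated c Z) (λ Z e _ → step-saturated c Z e)
                (edges G) σ (unique G , c≤d)

  approximation : ∀ (E' : List (Edge n)) → Unique E' → E' ⊆ edges G → Feasible c E' →
    length E' ≤ 2 * length Y
  approximation E' _ _ feasible' = begin
    length E'          ≤⟨ feasible-≤-∑c c E' feasible' ⟩
    ∑[ x < n ] c x     ≤⟨ ∑-mono (proj₂ saturated) ⟩
    ∑[ x < n ] deg Y x ≤⟨ ∑-deg Y ⟩
    2 * length Y       ∎
    where open ≤-Reasoning
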